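{- Let $G=(V,E)$ be a finite sober connected graph with $\mathrm{c\text{ - }rk}\,G=3$, and let $W\subseteq V$. Then $W$ is c-independent if and only if either $|W|\le 2$, or $|W|=3$, $\mathrm{St}(W)=\emptyset$ and $W$ is not a potential line.
   Context: Graphs are finite, undirected, without loops or multiple edges. $\mathrm{St}(v)$ is the set of vertices adjacent to $v$; $\mathrm{St}(W)=\bigcap_{w\in W}\mathrm{St}(w)$. $G$ is sober if the map $v\mapsto\mathrm{St}(v)$ is injective. $A^c$ is the $V\times V$ boolean matrix with $(i,j)$ entry $0$ if $\{i,j\}\in E$ and $1$ otherwise. Over the superboolean semiring $\mathbb{SB}=\{0,1,1^\nu\}$ (addition $0+x=x$, $1+1=1^\nu$, $1^\nu+x=1^\nu$; multiplication $0\cdot x=0$, $1\cdot1=1$, $1\cdot1^\nu=1^\nu\cdot1^\nu=1^\nu$), vectors are dependent if some combination with coefficients in $\{0,1\}$, not all zero, has all coordinates in $\{0,1^\nu\}$, and independent otherwise. A set $W$ of vertices is c-independent if the columns of $A^c$ indexed by $W$ are independent; $\mathrm{c\text{ - }rk}\,G$ is the maximum size of a c-independent set. A 3-subset $P\subseteq V$ is a potential line if $|P\cap\mathrm{St}(v)|\le1$ for every $v\in V$. -}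

module Defs where

open import Data.Nat using (ℕ; zero; suc; _≤_)
open import Data.Bool using (Bool; true; false; not)
open import Data.Fin using (Fin; zero; suc)
open import Data.Fin.Subset using (Subset; _∈_; _⊆_; _∩_; ∣_∣; Nonempty)
open import Data.Vec using (tabulate; lookup)
open import Data.Product using (Σ; ∃; _×_)
open import Data.Sum using (_⊎_)
open import Relation.Binary.PropositionalEquality using (_≡_)
open import Relation.Nullary using (¬_)

record Graph : Set where
  field
    n      : ℕ
    adj    : Fin n → Fin n → Bool
    adj-sym    : ∀ i j → adj i j ≡ adj j i
    adj-irrefl : ∀ i → adj i i ≡ false
open Graph public

St : (G : Graph) → Fin (n G) → Subset (n G)
St G v = tabulate (adj G v)

StEmpty : (G : Graph) → Subset (n G) → Set
StEmpty G W = ∀ v → ¬ (∀ w → w ∈ W → v ∈ St G w)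

Sober : Graph → Set
Sober G = ∀ u v → St G u ≡ St G v → u ≡ v

data Reach (G : Graph) : Fin (n G) → Fin (n G) → Set where
  here : ∀ {u} → Reach G u u
  step : ∀ {u v w} → adj G u v ≡ true → Reach G v w → Reach G u w

Connected : Graph → Set
Connected G = ∀ u v → Reach G u v

data SB : Set where
  𝟘 𝟙 𝟙ν : SB

_⊕_ : SB → SB → SB
𝟘 ⊕ x = x
𝟙 ⊕ 𝟘 = 𝟙
𝟙 ⊕ 𝟙 = 𝟙ν
𝟙 ⊕ 𝟙ν = 𝟙ν
𝟙ν ⊕ x = 𝟙ν

_⊗_ : SB → SB → SB
𝟘 ⊗ x = 𝟘
𝟙 ⊗ 𝟘 = 𝟘
𝟙 ⊗ 𝟙 = 𝟙
𝟙 ⊗ 𝟙ν = 𝟙ν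
𝟙ν ⊗ 𝟘 = 𝟘
𝟙ν ⊗ x = 𝟙ν

fromBool : Bool → SB
fromBool true = 𝟙
fromBool false = 𝟘

ΣSB : ∀ {m} → (Fin m → SB) → SB
ΣSB {zero} f = 𝟘
ΣSB {suc m} f = f zero ⊕ ΣSB (λ i → f (suc i))

GhostOrZero : SB → Set
GhostOrZero x = (x ≡ 𝟘) ⊎ (x ≡ 𝟙ν)

Ac : (G : Graph) → Fin (n G) → Fin (n G) → SB
Ac G i j = fromBool (not (adj G i j))

-- columns of A^c indexed by W are dependent: some {0,1}-combination
-- (coefficient vector c, supported in W, not all zero) has all
-- coordinates in {0, 1ν}
CDependent : (G : Graph) → Subset (n G) → Set
CDependent G W =
  Σ (Subset (n G)) λ c → c ⊆ W × Nonempty c ×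
    (∀ r → GhostOrZero (ΣSB (λ j → fromBool (lookup c j) ⊗ Ac G r j)))

CIndependent : (G : Graph) → Subset (n G) → Set
CIndependent G W = ¬ CDependent G W

CRank : Graph → ℕ → Set
CRank G k =
  (Σ (Subset (n G)) λ W → CIndependent G W × ∣ W ∣ ≡ k) ×
  (∀ W → CIndependent G W → ∣ W ∣ ≤ k)

PotentialLine : (G : Graph) → Subset (n G) → Set
PotentialLine G P = ∣ P ∣ ≡ 3 × (∀ v → ∣ P ∩ St G v ∣ ≤ 1)

module Submission where

-- Over the superboolean semiring, row r of the sum of the columns of A^c
-- indexed by a 0/1-vector c is the value of a sum of k ones, where
-- k = |c ∩ ∁St(r)| counts the columns of c that are not adjacent to r; this
-- value is 0 or 1ν exactly when k ≠ 1.  So W is c-dependent iff some nonempty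
-- c ⊆ W is a "dependency": no row has exactly one non-neighbour in c.
--
-- Three graph facts then give the theorem:
--   * in a sober graph every nonempty dependency has at least three vertices
--     (a dependency {u, v} would force St(u) = St(v));
--   * adding a common neighbour v of W keeps W c-independent, since in row v
--     the vertex v is the only non-neighbour of v;
--   * a potential line is a dependency, while a 3-set W with St(W) = ∅ that is
--     not a potential line has a row with exactly one non-neighbour in W.

open import Defs
open import Data.Nat using (ℕ; zero; suc; _+_; _≤_; z≤n; s≤s; _≤?_)
open import Data.Nat.Properties using (≤-trans; ≤-antisym; ≰⇒>; ≮⇒≥; <⇒≱; +-suc; suc-injective)
open import Data.Bool using (true; false; not; _∧_)
open import Data.Fin using (Fin; _≟_)
open import Data.Fin.Properties using (any?; ¬∀⟶∃¬)
open import Data.Fin.Subset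
  using (Subset; _∈_; _∉_; _⊆_; _⊂_; _∩_; _∪_; ∁; ⁅_⁆; ∣_∣; Nonempty; _-_)
open import Data.Fin.Subset.Properties
  using ( _∈?_; ⊆-antisym; p⊆q⇒∣p∣≤∣q∣; p⊂q⇒∣p∣<∣q∣; x∈p⇒∣p-x∣<∣p∣; x∈p∧x≢y⇒x∈p-y
        ; x∈⁅x⁆; x∈⁅y⁆⇒x≡y; ∣⁅x⁆∣≡1; x∈p∩q⁺; x∈p∩q⁻; p∩q⊆p; p∩q⊆q
        ; p⊆p∪q; q⊆p∪q; x∈p∪q⁻; x∉p⇒x∈∁p; x∈∁p⇒x∉p
        ; nonempty?; Empty-unique; ∣⊥∣≡0 )
open import Data.Vec using ([]; _∷_; lookup)
open import Data.Vec.Properties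
  using ([]=⇒lookup; lookup⇒[]=; lookup∘tabulate; lookup-map; tabulate-cong)
open import Data.Product using (∃; _×_; _,_; proj₁; proj₂)
open import Data.Sum using (_⊎_; inj₁; inj₂; swap)
open import Data.Empty using (⊥; ⊥-elim)
open import Function using (_∘_)
open import Relation.Binary.PropositionalEquality
  using (_≡_; _≢_; refl; sym; trans; cong; cong₂; subst)
open import Relation.Nullary using (¬_; yes; no; ¬?; _×-dec_)
open import Function.Bundles using (_⇔_; mk⇔)

∣p∣≡1 : ∀ {m} {p : Subset m} {x : Fin m} → x ∈ p → (∀ {y} → y ∈ p → y ≡ x) → ∣ p ∣ ≡ 1
∣p∣≡1 {p = p} {x} x∈p only = trans (cong ∣_∣ p≡⁅x⁆) (∣⁅x⁆∣≡1 x)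
  where
  p≡⁅x⁆ : p ≡ ⁅ x ⁆
  p≡⁅x⁆ = ⊆-antisym (λ y∈p → subst (_∈ ⁅ x ⁆) (sym (only y∈p)) (x∈⁅x⁆ x))
                    (λ y∈⁅x⁆ → subst (_∈ p) (sym (x∈⁅y⁆⇒x≡y x y∈⁅x⁆)) x∈p)

another-element : ∀ {m} {p : Subset m} {x : Fin m} →
  x ∈ p → ∣ p ∣ ≢ 1 → ∃ λ y → y ∈ p × y ≢ x
another-element {p = p} {x} x∈p ∣p∣≢1 with any? (λ y → (y ∈? p) ×-dec ¬? (y ≟ x))
... | yes companion = companion
... | no none = ⊥-elim (∣p∣≢1 (∣p∣≡1 x∈p only))
  where
  only : ∀ {y} → y ∈ p → y ≡ x
  only {y} y∈p with y ≟ x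
  ... | yes y≡x = y≡x
  ... | no y≢x = ⊥-elim (none (y , y∈p , y≢x))

three-distinct : ∀ {m} {p : Subset m} {x y z : Fin m} → x ∈ p → y ∈ p → z ∈ p →
  x ≢ y → x ≢ z → y ≢ z → 3 ≤ ∣ p ∣
three-distinct {p = p} {x} {y} x∈p y∈p z∈p x≢y x≢z y≢z =
  ≤-trans (s≤s (≤-trans (s≤s 1≤∣p-x-y∣) (x∈p⇒∣p-x∣<∣p∣ y∈p-x))) (x∈p⇒∣p-x∣<∣p∣ x∈p)
  where
  y∈p-x : y ∈ p - x
  y∈p-x = x∈p∧x≢y⇒x∈p-y y∈p (x≢y ∘ sym)
  1≤∣p-x-y∣ : 1 ≤ ∣ p - x - y ∣
  1≤∣p-x-y∣ = ≤-trans (s≤s z≤n)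
    (x∈p⇒∣p-x∣<∣p∣ (x∈p∧x≢y⇒x∈p-y (x∈p∧x≢y⇒x∈p-y z∈p (x≢z ∘ sym)) (y≢z ∘ sym)))

⊆-of-full-size : ∀ {m} {p q : Subset m} → p ⊆ q → ∣ q ∣ ≤ ∣ p ∣ → q ⊆ p
⊆-of-full-size {p = p} p⊆q ∣q∣≤∣p∣ {x} x∈q with x ∈? p
... | yes x∈p = x∈p
... | no x∉p = ⊥-elim (<⇒≱ (p⊂q⇒∣p∣<∣q∣ (p⊆q , x , x∈q , x∉p)) ∣q∣≤∣p∣)

nonempty-of-size : ∀ {m} {p : Subset m} → 1 ≤ ∣ p ∣ → Nonempty p
nonempty-of-size {m} {p} 1≤∣p∣ with nonempty? p
... | yes nonempty = nonempty
... | no empty with () ← subst (1 ≤_) (trans (cong ∣_∣ (Empty-unique empty)) (∣⊥∣≡0 m)) 1≤∣p∣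

∣p∣≡∣p∩q∣+∣p∩∁q∣ : ∀ {m} (p q : Subset m) → ∣ p ∣ ≡ ∣ p ∩ q ∣ + ∣ p ∩ ∁ q ∣
∣p∣≡∣p∩q∣+∣p∩∁q∣ [] [] = refl
∣p∣≡∣p∩q∣+∣p∩∁q∣ (true ∷ p) (true ∷ q) = cong suc (∣p∣≡∣p∩q∣+∣p∩∁q∣ p q)
∣p∣≡∣p∩q∣+∣p∩∁q∣ (true ∷ p) (false ∷ q) =
  trans (cong suc (∣p∣≡∣p∩q∣+∣p∩∁q∣ p q)) (sym (+-suc ∣ p ∩ q ∣ ∣ p ∩ ∁ q ∣))
∣p∣≡∣p∩q∣+∣p∩∁q∣ (false ∷ p) (_ ∷ q) = ∣p∣≡∣p∩q∣+∣p∩∁q∣ p q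

unique-outside : ∀ {m} {p q : Subset m} {x : Fin m} → x ∈ p → x ∉ q →
  (∀ {y} → y ∈ p → y ≢ x → y ∈ q) → ∣ p ∩ ∁ q ∣ ≡ 1
unique-outside {p = p} {q} {x} x∈p x∉q others-in-q =
  ∣p∣≡1 (x∈p∩q⁺ (x∈p , x∉p⇒x∈∁p x∉q)) only
  where
  only : ∀ {y} → y ∈ p ∩ ∁ q → y ≡ x
  only {y} y∈ with y ≟ x
  ... | yes y≡x = y≡x
  ... | no y≢x = ⊥-elim (x∈∁p⇒x∉p (proj₂ (x∈p∩q⁻ p (∁ q) y∈)) (others-in-q (p∩q⊆p p (∁ q) y∈) y≢x))

∈-∪-singleton : ∀ {m} {p : Subset m} {v w : Fin m} → w ∈ p ∪ ⁅ v ⁆ → w ≢ v → w ∈ p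
∈-∪-singleton {p = p} {v} w∈ w≢v with x∈p∪q⁻ p ⁅ v ⁆ w∈
... | inj₁ w∈p = w∈p
... | inj₂ w∈⁅v⁆ = ⊥-elim (w≢v (x∈⁅y⁆⇒x≡y v w∈⁅v⁆))

-- The value of a superboolean sum of k ones.
ones : ℕ → SB
ones 0 = 𝟘
ones 1 = 𝟙
ones (suc (suc _)) = 𝟙ν

ghost-ones⇒≢1 : ∀ k → GhostOrZero (ones k) → k ≢ 1
ghost-ones⇒≢1 .1 (inj₁ ()) refl
ghost-ones⇒≢1 .1 (inj₂ ()) refl

≢1⇒ghost-ones : ∀ k → k ≢ 1 → GhostOrZero (ones k)
≢1⇒ghost-ones 0 _ = inj₁ refl
≢1⇒ghost-ones 1 1≢1 = ⊥-elim (1≢1 refl)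
≢1⇒ghost-ones (suc (suc _)) _ = inj₂ refl

fromBool-⊗ : ∀ a b → fromBool a ⊗ fromBool b ≡ fromBool (a ∧ b)
fromBool-⊗ false _ = refl
fromBool-⊗ true false = refl
fromBool-⊗ true true = refl

fromBool-⊕-ones : ∀ {m} b (r : Subset m) → fromBool b ⊕ ones ∣ r ∣ ≡ ones ∣ b ∷ r ∣
fromBool-⊕-ones false r = refl
fromBool-⊕-ones true r with ∣ r ∣
... | 0 = refl
... | 1 = refl
... | suc (suc _) = refl

ΣSB-cong : ∀ {m} {f g : Fin m → SB} → (∀ j → f j ≡ g j) → ΣSB f ≡ ΣSB g
ΣSB-cong {zero} _ = refl
ΣSB-cong {suc m} f≗g = cong₂ _⊕_ (f≗g Fin.zero) (ΣSB-cong (f≗g ∘ Fin.suc))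

ΣSB-∩ : ∀ {m} (p q : Subset m) →
  ΣSB (λ j → fromBool (lookup p j) ⊗ fromBool (lookup q j)) ≡ ones ∣ p ∩ q ∣
ΣSB-∩ [] [] = refl
ΣSB-∩ (a ∷ p) (b ∷ q) =
  trans (cong₂ _⊕_ (fromBool-⊗ a b) (ΣSB-∩ p q)) (fromBool-⊕-ones (a ∧ b) (p ∩ q))

module _ (G : Graph) where

  V : Set
  V = Fin (n G)

  -- The non-neighbours of r (including r itself): the support of row r of A^c.
  NonNbr : V → Subset (n G)
  NonNbr r = ∁ (St G r)

  ∈St⇒adj : ∀ {r w} → w ∈ St G r → adj G r w ≡ true
  ∈St⇒adj {r} {w} w∈ = trans (sym (lookup∘tabulate (adj G r) w)) ([]=⇒lookup w∈)

  adj⇒∈St : ∀ {r w} → adj G r w ≡ true → w ∈ St G r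
  adj⇒∈St {r} {w} e = lookup⇒[]= w (St G r) (trans (lookup∘tabulate (adj G r) w) e)

  ¬adj⇒∉St : ∀ {r w} → adj G r w ≡ false → w ∉ St G r
  ¬adj⇒∉St e w∈ with () ← trans (sym e) (∈St⇒adj w∈)

  St-sym : ∀ {r w} → w ∈ St G r → r ∈ St G w
  St-sym {r} {w} w∈ = adj⇒∈St (trans (adj-sym G w r) (∈St⇒adj w∈))

  self∉St : ∀ v → v ∉ St G v
  self∉St v = ¬adj⇒∉St (adj-irrefl G v)

  row-sum : ∀ c r → ΣSB (λ j → fromBool (lookup c j) ⊗ Ac G r j) ≡ ones ∣ c ∩ NonNbr r ∣
  row-sum c r = trans (ΣSB-cong entry) (ΣSB-∩ c (NonNbr r))
    where
    entry : ∀ j → fromBool (lookup c j) ⊗ Ac G r j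
                ≡ fromBool (lookup c j) ⊗ fromBool (lookup (NonNbr r) j)
    entry j = cong (λ b → fromBool (lookup c j) ⊗ fromBool b)
      (sym (trans (lookup-map j not (St G r)) (cong not (lookup∘tabulate (adj G r) j))))

  IsDependency : Subset (n G) → Set
  IsDependency c = ∀ r → ∣ c ∩ NonNbr r ∣ ≢ 1

  CDependent⇒dependency : ∀ {W} → CDependent G W →
    ∃ λ c → c ⊆ W × Nonempty c × IsDependency c
  CDependent⇒dependency (c , c⊆W , nonempty , ghost) =
    c , c⊆W , nonempty , λ r → ghost-ones⇒≢1 _ (subst GhostOrZero (row-sum c r) (ghost r))

  dependency⇒CDependent : ∀ {W c} → c ⊆ W → Nonempty c → IsDependency c → CDependent G W
  dependency⇒CDependent {c = c} c⊆W nonempty dep =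
    c , c⊆W , nonempty , λ r → subst GhostOrZero (sym (row-sum c r)) (≢1⇒ghost-ones _ (dep r))

  -- In a sober graph a nonempty dependency has at least three vertices:
  -- row u yields a second vertex v, and if c were just {u, v} every row
  -- would treat u and v alike, giving St(u) = St(v).
  dependency-size : Sober G → ∀ {c} → Nonempty c → IsDependency c → 3 ≤ ∣ c ∣
  dependency-size sober {c} (u , u∈c) dep with 3 ≤? ∣ c ∣
  ... | yes large = large
  ... | no small = ⊥-elim (v≢u (sober v u St-v≡St-u))
    where
    partner : ∃ λ v → v ∈ c ∩ NonNbr u × v ≢ u
    partner = another-element (x∈p∩q⁺ (u∈c , x∉p⇒x∈∁p (self∉St u))) (dep u)
    v : V
    v = proj₁ partner
    v∈c : v ∈ c
    v∈c = p∩q⊆p c (NonNbr u) (proj₁ (proj₂ partner))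
    v≢u : v ≢ u
    v≢u = proj₂ (proj₂ partner)

    pair : ∀ {w} → w ∈ c → w ≡ u ⊎ w ≡ v
    pair {w} w∈c with w ≟ u | w ≟ v
    ... | yes w≡u | _ = inj₁ w≡u
    ... | no _ | yes w≡v = inj₂ w≡v
    ... | no w≢u | no w≢v =
      ⊥-elim (small (three-distinct u∈c v∈c w∈c (v≢u ∘ sym) (w≢u ∘ sym) (w≢v ∘ sym)))

    split-row : ∀ {r x y} → x ∈ c → x ∉ St G r → y ∈ St G r →
      (∀ {w} → w ∈ c → w ≡ x ⊎ w ≡ y) → ⊥
    split-row {r} {x} x∈c x∉ y∈ spans = dep r (unique-outside x∈c x∉ others)
      where
      others : ∀ {w} → w ∈ c → w ≢ x → w ∈ St G r
      others w∈c w≢x with spans w∈c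
      ... | inj₁ w≡x = ⊥-elim (w≢x w≡x)
      ... | inj₂ refl = y∈

    same-row : ∀ r → adj G r u ≡ adj G r v
    same-row r with adj G r u in ru | adj G r v in rv
    ... | true | true = refl
    ... | false | false = refl
    ... | false | true = ⊥-elim (split-row u∈c (¬adj⇒∉St ru) (adj⇒∈St rv) pair)
    ... | true | false = ⊥-elim (split-row v∈c (¬adj⇒∉St rv) (adj⇒∈St ru) (swap ∘ pair))

    St-v≡St-u : St G v ≡ St G u
    St-v≡St-u = tabulate-cong λ r →
      trans (adj-sym G v r) (trans (sym (same-row r)) (adj-sym G r u))

  small-independent : Sober G → ∀ W → ∣ W ∣ ≤ 2 → CIndependent G W
  small-independent sober W ∣W∣≤2 dep with CDependent⇒dependency dep
  ... | c , c⊆W , nonempty , isDep =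
    <⇒≱ (≤-trans (dependency-size sober nonempty isDep) (p⊆q⇒∣p∣≤∣q∣ c⊆W)) ∣W∣≤2

  CommonNeighbour : Subset (n G) → V → Set
  CommonNeighbour W v = ∀ w → w ∈ W → v ∈ St G w

  common-neighbour-new : ∀ {W v} → CommonNeighbour W v → W ⊂ W ∪ ⁅ v ⁆
  common-neighbour-new {W} {v} common =
    p⊆p∪q ⁅ v ⁆ , v , q⊆p∪q W ⁅ v ⁆ (x∈⁅x⁆ v) , λ v∈W → self∉St v (common v v∈W)

  -- Adding a common neighbour v keeps W c-independent: a dependency using v
  -- fails in row v, where v is the only non-neighbour of v.
  common-neighbour-independent : ∀ {W v} → CommonNeighbour W v →
    CIndependent G W → CIndependent G (W ∪ ⁅ v ⁆)
  common-neighbour-independent {W} {v} common indep dep with CDependent⇒dependency dep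
  ... | c , c⊆W∪v , nonempty , isDep with v ∈? c
  ... | yes v∈c = isDep v (unique-outside v∈c (self∉St v) λ w∈c w≢v →
                    St-sym (common _ (∈-∪-singleton (c⊆W∪v w∈c) w≢v)))
  ... | no v∉c = indep (dependency⇒CDependent c⊆W nonempty isDep)
    where
    c⊆W : c ⊆ W
    c⊆W w∈c = ∈-∪-singleton (c⊆W∪v w∈c) λ { refl → v∉c w∈c }

  -- A potential line is c-dependent: each row misses at least two of its points.
  potential-line-dependent : ∀ {W} → PotentialLine G W → CDependent G W
  potential-line-dependent {W} (∣W∣≡3 , thin) =
    dependency⇒CDependent (λ w∈W → w∈W) nonempty misses-two
    where
    nonempty : Nonempty W
    nonempty = nonempty-of-size (subst (1 ≤_) (sym ∣W∣≡3) (s≤s z≤n))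
    at-most-one-neighbour : ∀ {a b} → a + b ≡ 3 → a ≤ 1 → b ≢ 1
    at-most-one-neighbour {zero} () _ refl
    at-most-one-neighbour {suc zero} () _ refl
    at-most-one-neighbour {suc (suc _)} _ (s≤s ()) refl
    misses-two : IsDependency W
    misses-two r = at-most-one-neighbour (trans (sym (∣p∣≡∣p∩q∣+∣p∩∁q∣ W (St G r))) ∣W∣≡3) (thin r)

  -- A 3-set with St(W) = ∅ that is not a potential line is not a dependency:
  -- some v is adjacent to two, but not all three, of its vertices.
  not-line-not-dependency : ∀ {W} → ∣ W ∣ ≡ 3 → StEmpty G W → ¬ PotentialLine G W →
    ¬ IsDependency W
  not-line-not-dependency {W} ∣W∣≡3 no-common not-line isDep
    with ¬∀⟶∃¬ (n G) (λ v → ∣ W ∩ St G v ∣ ≤ 1) (λ v → ∣ W ∩ St G v ∣ ≤? 1) (not-line ∘ (∣W∣≡3 ,_))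
  ... | v , ¬≤1 = isDep v (one-non-neighbour split (≰⇒> ¬≤1) (≮⇒≥ not-all))
    where
    split : ∣ W ∩ St G v ∣ + ∣ W ∩ NonNbr v ∣ ≡ 3
    split = trans (sym (∣p∣≡∣p∩q∣+∣p∩∁q∣ W (St G v))) ∣W∣≡3
    one-non-neighbour : ∀ {a b} → a + b ≡ 3 → 2 ≤ a → a ≤ 2 → b ≡ 1
    one-non-neighbour a+b≡3 2≤a a≤2 rewrite ≤-antisym a≤2 2≤a = suc-injective (suc-injective a+b≡3)
    not-all : ¬ (3 ≤ ∣ W ∩ St G v ∣)
    not-all 3≤ = no-common v λ w w∈W → St-sym (p∩q⊆q W (St G v) (W⊆St-v w∈W))
      where
      W⊆St-v : W ⊆ W ∩ St G v
      W⊆St-v = ⊆-of-full-size (p∩q⊆p W (St G v)) (subst (_≤ ∣ W ∩ St G v ∣) (sym ∣W∣≡3) 3≤)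

  -- So such a 3-set is c-independent: by dependency-size any dependency inside
  -- W is all of W.
  line-free-triple-independent : Sober G → ∀ W → ∣ W ∣ ≡ 3 → StEmpty G W →
    ¬ PotentialLine G W → CIndependent G W
  line-free-triple-independent sober W ∣W∣≡3 no-common not-line dep with CDependent⇒dependency dep
  ... | c , c⊆W , nonempty , isDep =
    not-line-not-dependency ∣W∣≡3 no-common not-line (subst IsDependency c≡W isDep)
    where
    c≡W : c ≡ W
    c≡W = ⊆-antisym c⊆W
      (⊆-of-full-size c⊆W (subst (_≤ ∣ c ∣) (sym ∣W∣≡3) (dependency-size sober nonempty isDep)))

theorem5p3 : (G : Graph) → Sober G → Connected G → CRank G 3 →
    (W : Subset (n G)) →
    CIndependent G W ⇔ (∣ W ∣ ≤ 2 ⊎ (∣ W ∣ ≡ 3 × StEmpty G W × ¬ PotentialLine G W))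
theorem5p3 G sober _ (_ , rank≤3) W = mk⇔ forward backward
  where
  forward : CIndependent G W → ∣ W ∣ ≤ 2 ⊎ (∣ W ∣ ≡ 3 × StEmpty G W × ¬ PotentialLine G W)
  forward indep with ∣ W ∣ ≤? 2
  ... | yes small = inj₁ small
  ... | no ¬small = inj₂ (∣W∣≡3 , no-common , indep ∘ potential-line-dependent G)
    where
    ∣W∣≡3 : ∣ W ∣ ≡ 3
    ∣W∣≡3 = ≤-antisym (rank≤3 W indep) (≰⇒> ¬small)
    -- a common neighbour would give a c-independent set of size four
    no-common : StEmpty G W
    no-common v common = <⇒≱ (p⊂q⇒∣p∣<∣q∣ (common-neighbour-new G common))
      (subst (∣ W ∪ ⁅ v ⁆ ∣ ≤_) (sym ∣W∣≡3)
        (rank≤3 _ (common-neighbour-independent G common indep)))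

  backward : ∣ W ∣ ≤ 2 ⊎ (∣ W ∣ ≡ 3 × StEmpty G W × ¬ PotentialLine G W) → CIndependent G W
  backward (inj₁ small) = small-independent G sober W small
  backward (inj₂ (∣W∣≡3 , no-common , not-line)) =
    line-free-triple-independent G sober W ∣W∣≡3 no-common not-line
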